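{- For integers $k\ge0$ and $i\ge 0$, let $f_{k,i}(x)=\sum_{e} x^{\mathrm{len}(e)-k-1}$, where the sum runs over all primitive ascent sequences $e$ (of any length $\ge1$) that avoid $\underline{12}0$, have $\mathrm{asc}(e)=k$, and have last entry equal to $i$. Then $f_{0,0}(x)=1$, $f_{k,i}(x)=0$ whenever $k<i$, and for all $k\geq0$ and $0\leq i\leq k+1$, $$f_{k+1,i}(x)=\sum_{j=0}^{i}(1+x)^{k+1-i}f_{k,j}(x)-f_{k,i}(x).$$
   Context: An inversion sequence of length $n$ is an integer sequence $e=e_1\ldots e_n$ with $0\le e_i<i$ for all $i$; $\mathrm{len}(e)=n$. $\mathrm{asc}(e_1\ldots e_i)=|\{\ell\in[i-1]:e_\ell<e_{\ell+1}\}|$. An ascent sequence is an inversion sequence $e$ with $e_{i+1}\le \mathrm{asc}(e_1\ldots e_i)+1$ for all $1\le i<n$; it is primitive if $e_i\neq e_{i+1}$ for all $i\in[n-1]$. A sequence $e$ avoids $\underline{12}0$ if there are no indices $2\le i<j\le n$ with $e_j<e_{i-1}<e_i$. -}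

module Defs where

open import Data.Nat using (ℕ; zero; suc; _+_; _∸_; _<ᵇ_; _≡ᵇ_)
open import Data.Bool using (Bool; true; false; _∧_; _∨_; not; if_then_else_)
open import Data.List using (List; []; _∷_; _++_; [_]; map; concatMap; upTo; length; take)
open import Data.Bool.ListAction using (all; any)
open import Data.Integer as ℤ using (ℤ; +_)

-- Sequences e = e₁ … eₙ are lists (e₁ first).

-- 0-indexed access: at e p = e_{p+1} (default 0 outside range; only used in range)
at : List ℕ → ℕ → ℕ
at []       _       = 0
at (x ∷ xs) zero    = x
at (x ∷ xs) (suc p) = at xs p

-- all inversion sequences of length n: e_i < i (built by appending e_n < n)
invSeqs : ℕ → List (List ℕ)
invSeqs zero    = [] ∷ []
invSeqs (suc n) = concatMap (λ e → map (λ v → e ++ [ v ]) (upTo (suc n))) (invSeqs n)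

asc : List ℕ → ℕ
asc []           = 0
asc (x ∷ [])     = 0
asc (x ∷ y ∷ xs) = (if x <ᵇ y then 1 else 0) + asc (y ∷ xs)

-- ascent condition: e_{i+1} ≤ asc(e₁…e_i) + 1 for 1 ≤ i < n
isAscentSeq : List ℕ → Bool
isAscentSeq e = all (λ i → at e i <ᵇ asc (take i e) + 2) (map suc (upTo (length e ∸ 1)))

isPrimitive : List ℕ → Bool
isPrimitive []           = true
isPrimitive (x ∷ [])     = true
isPrimitive (x ∷ y ∷ xs) = not (x ≡ᵇ y) ∧ isPrimitive (y ∷ xs)

-- contains 1̲2̲0: indices 2 ≤ i < j ≤ n with e_j < e_{i-1} < e_i
-- (0-indexed: 1 ≤ p < q ≤ n-1 with e[q] < e[p-1] < e[p])
contains12̲0 : List ℕ → Bool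
contains12̲0 e =
  any (λ p → any (λ q → (p <ᵇ q) ∧ (at e q <ᵇ at e (p ∸ 1)) ∧ (at e (p ∸ 1) <ᵇ at e p))
                 (upTo (length e)))
      (map suc (upTo (length e ∸ 1)))

avoids12̲0 : List ℕ → Bool
avoids12̲0 e = not (contains12̲0 e)

lastIs : ℕ → List ℕ → Bool
lastIs i []           = false
lastIs i (x ∷ [])     = x ≡ᵇ i
lastIs i (x ∷ y ∷ xs) = lastIs i (y ∷ xs)

counted : ℕ → ℕ → List ℕ → Bool
counted k i e = isAscentSeq e ∧ isPrimitive e ∧ avoids12̲0 e ∧ (asc e ≡ᵇ k) ∧ lastIs i e

countB : (List ℕ → Bool) → List (List ℕ) → ℕ
countB P []       = 0
countB P (x ∷ xs) = (if P x then 1 else 0) + countB P xs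

-- Formal power series over ℤ: coefficient functions, equality pointwise.

FPS : Set
FPS = ℕ → ℤ

-- f_{k,i}(x) = Σ_e x^{len(e)-k-1}: coefficient of x^m counts sequences of
-- length m+k+1 (length ≥ 1 and asc(e) ≤ len(e)-1 make every exponent ≥ 0)
f : ℕ → ℕ → FPS
f k i m = + countB (counted k i) (invSeqs (m + k + 1))

oneF : FPS
oneF zero    = + 1
oneF (suc _) = + 0

zeroF : FPS
zeroF _ = + 0

_⊕_ : FPS → FPS → FPS
(a ⊕ b) n = a n ℤ.+ b n

_⊖_ : FPS → FPS → FPS
(a ⊖ b) n = a n ℤ.- b n

sumTo : ℕ → (ℕ → ℤ) → ℤ
sumTo zero    g = g 0
sumTo (suc n) g = sumTo n g ℤ.+ g (suc n)

_⊛_ : FPS → FPS → FPS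
(a ⊛ b) n = sumTo n (λ t → a t ℤ.* b (n ∸ t))

onePlusX : FPS
onePlusX zero          = + 1
onePlusX (suc zero)    = + 1
onePlusX (suc (suc _)) = + 0

onePlusXPow : ℕ → FPS
onePlusXPow zero    = oneF
onePlusXPow (suc n) = onePlusX ⊛ onePlusXPow n

sumF : ℕ → (ℕ → FPS) → FPS
sumF i F n = sumTo i (λ j → F j n)

module Submission where

-- Besides asc e and its last entry, a sequence e has a floor: the largest lower
-- end of an ascent.  Appending v to a valid sequence e (valid = ascent sequence,
-- primitive, avoiding 1̲2̲0) keeps it valid iff v ≤ asc e + 1, v ≠ last e and v is not
-- below the floor (valid-∷ʳ); the new occurrences of 1̲2̲0 are exactly those ending in v.
-- Along the construction of inversion sequences, floor ≤ last ≤ asc (Sound, shapes).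
-- Refining the count F_n(k,i) (length n, asc k, last i) by the floor b to G_n(k,i,b),
-- each counted sequence of length n+2 arises from one of length n+1 by a descent
-- (asc and floor kept) or an ascent (old last entry becomes the floor) (G-step).
-- Induction on the length with the hockey stick identity turns this into the closed
-- form G_{p+1}(k+1,i,b) + [b=i] F_p(k,b) = Σ_t C(k+1-i,t) F_{p-t}(k,b) (closed-form);
-- summing over b ≤ i gives the recurrence for the power series f_{k,i}.

open import Defs
open import Data.Nat using (ℕ; zero; suc; _+_; _*_; _∸_; _<_; _≤_; _≮_; _<ᵇ_; _≡ᵇ_; _⊔_; z≤n; s≤s; z<s; s<s)
open import Data.Nat.Properties
open import Data.Bool using (Bool; true; false; T; _∧_; _∨_; not; if_then_else_)
open import Data.Bool.Properties using (∧-idempotentCommutativeMonoid; ∧-assoc; ∨-assoc; ∨-comm; ∨-identityʳ; ∧-identityʳ; ∧-zeroʳ)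
open import Data.Bool.ListAction using (and; or; all; any)
open import Data.List using (List; []; _∷_; _++_; [_]; _∷ʳ_; map; concatMap; upTo; applyUpTo; length; take)
open import Data.List.Properties using (upTo-∷ʳ; map-++; map-∘; map-cong-local; map-upTo; map-applyUpTo; length-++; take-all)
open import Data.List.Relation.Unary.All as All using (All; []; _∷_)
open import Data.List.Relation.Unary.All.Properties using (applyUpTo⁺₁; map⁺; concat⁺)
open import Data.Unit using (tt)
open import Data.Empty using (⊥-elim)
open import Data.Product using (_×_; _,_; proj₁; proj₂)
open import Function using (_∘_)
open import Relation.Nullary using (¬_; Dec; yes; no)
open import Relation.Nullary.Reflects using (Reflects; ofʸ; ofⁿ)
open import Data.Nat.Combinatorics using (_C_; nCk+nC[k+1]≡[n+1]C[k+1])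
open import Data.Integer as ℤ using (ℤ)
import Data.Integer.Properties as ℤ
open import Relation.Binary.PropositionalEquality hiding ([_])
open import Algebra.Properties.CommutativeSemigroup +-commutativeSemigroup using (x∙yz≈y∙xz; interchange)
open import Algebra.Solver.IdempotentCommutativeMonoid ∧-idempotentCommutativeMonoid
  using (solve; _⊜_) renaming (_⊕_ to _∧′_; id to true′)

⟦_⟧ : Bool → ℕ
⟦ b ⟧ = if b then 1 else 0

and⁻ : ∀ bs → T (and bs) → All T bs
and⁻ []          _ = []
and⁻ (true ∷ bs) h = tt ∷ and⁻ bs h

and⁺ : ∀ {bs} → All T bs → T (and bs)
and⁺ []                  = tt
and⁺ {true ∷ _} (_ ∷ hs) = and⁺ hs

∧-elim : ∀ {a b} → T (a ∧ b) → T a × T b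
∧-elim {true} t = tt , t

∧-intro : ∀ {a b} → T a → T b → T (a ∧ b)
∧-intro {true} _ t = t

not-intro : ∀ {a} → ¬ T a → T (not a)
not-intro {false} _  = tt
not-intro {true}  ¬a = ¬a tt

not-elim : ∀ {a} → T (not a) → ¬ T a
not-elim {false} _ ()

T-ext : ∀ {a b} → (T a → T b) → (T b → T a) → a ≡ b
T-ext {false} {false} _ _ = refl
T-ext {false} {true}  _ g = ⊥-elim (g tt)
T-ext {true}  {false} f _ = ⊥-elim (f tt)
T-ext {true}  {true}  _ _ = refl

T-true : ∀ {a} → T a → a ≡ true
T-true {true} _ = refl

T-false : ∀ {a} → ¬ T a → a ≡ false
T-false {false} _  = refl
T-false {true}  ¬a = ⊥-elim (¬a tt)

≢ᵇ⇒≢ : ∀ {m n} → T (not (m ≡ᵇ n)) → m ≢ n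
≢ᵇ⇒≢ {m} {n} h m≡n = not-elim h (≡⇒≡ᵇ m n m≡n)

≢⇒≢ᵇ : ∀ {m n} → m ≢ n → T (not (m ≡ᵇ n))
≢⇒≢ᵇ {m} {n} m≢n = not-intro (m≢n ∘ ≡ᵇ⇒≡ m n)

≮ᵇ⇒≥ : ∀ {m n} → T (not (m <ᵇ n)) → n ≤ m
≮ᵇ⇒≥ h = ≮⇒≥ (not-elim h ∘ <⇒<ᵇ)

≥⇒≮ᵇ : ∀ {m n} → n ≤ m → T (not (m <ᵇ n))
≥⇒≮ᵇ {m} {n} n≤m = not-intro (λ m<ᵇn → ≤⇒≯ n≤m (<ᵇ⇒< m n m<ᵇn))

not-∨ : ∀ a b → not (a ∨ b) ≡ not a ∧ not b
not-∨ false b = refl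
not-∨ true  b = refl

<ᵇ-⊔ : ∀ v a b → (v <ᵇ (a ⊔ b)) ≡ (v <ᵇ a) ∨ (v <ᵇ b)
<ᵇ-⊔ v       zero    b       = refl
<ᵇ-⊔ zero    (suc a) zero    = refl
<ᵇ-⊔ zero    (suc a) (suc b) = refl
<ᵇ-⊔ (suc v) (suc a) zero    = sym (∨-identityʳ _)
<ᵇ-⊔ (suc v) (suc a) (suc b) = <ᵇ-⊔ v a b

and-++ : ∀ bs cs → and (bs ++ cs) ≡ and bs ∧ and cs
and-++ []           cs = refl
and-++ (true ∷ bs)  cs = and-++ bs cs
and-++ (false ∷ bs) cs = refl

or-++ : ∀ bs cs → or (bs ++ cs) ≡ or bs ∨ or cs
or-++ []           cs = refl
or-++ (true ∷ bs)  cs = refl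
or-++ (false ∷ bs) cs = or-++ bs cs

all-upTo-∷ʳ : ∀ (P : ℕ → Bool) n → all P (upTo (suc n)) ≡ all P (upTo n) ∧ P n
all-upTo-∷ʳ P n =
  trans (cong (all P) (sym (upTo-∷ʳ n)))
        (trans (cong and (map-++ P (upTo n) [ n ]))
               (trans (and-++ (map P (upTo n)) [ P n ]) (cong (all P (upTo n) ∧_) (∧-identityʳ (P n)))))

any-upTo-∷ʳ : ∀ (P : ℕ → Bool) n → any P (upTo (suc n)) ≡ any P (upTo n) ∨ P n
any-upTo-∷ʳ P n =
  trans (cong (any P) (sym (upTo-∷ʳ n)))
        (trans (cong or (map-++ P (upTo n) [ n ]))
               (trans (or-++ (map P (upTo n)) [ P n ]) (cong (any P (upTo n) ∨_) (∨-identityʳ (P n)))))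

map-upTo-cong : ∀ {P Q : ℕ → Bool} n → (∀ i → i < n → P i ≡ Q i) → map P (upTo n) ≡ map Q (upTo n)
map-upTo-cong n eq = map-cong-local (applyUpTo⁺₁ (λ i → i) n (eq _))

map-shift : ∀ (P : ℕ → Bool) n → map P (applyUpTo suc n) ≡ map (P ∘ suc) (upTo n)
map-shift P n = trans (map-applyUpTo suc P n) (sym (map-upTo (P ∘ suc) n))

any-∨ : ∀ {A : Set} (P Q : A → Bool) xs → any (λ a → P a ∨ Q a) xs ≡ any P xs ∨ any Q xs
any-∨ P Q []       = refl
any-∨ P Q (x ∷ xs) = trans (cong ((P x ∨ Q x) ∨_) (any-∨ P Q xs)) (swap (P x) (Q x) _ _)
  where
  swap : ∀ a b c d → (a ∨ b) ∨ (c ∨ d) ≡ (a ∨ c) ∨ (b ∨ d)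
  swap false b c d = trans (sym (∨-assoc b c d)) (trans (cong (_∨ d) (∨-comm b c)) (∨-assoc c b d))
  swap true  b c d = refl

any-upTo-false : ∀ (P : ℕ → Bool) m → (∀ q → q < m → ¬ T (P q)) → any P (upTo m) ≡ false
any-upTo-false P zero    _ = refl
any-upTo-false P (suc m) h =
  trans (any-upTo-∷ʳ P m)
        (cong₂ _∨_ (any-upTo-false P m (λ q q<m → h q (m<n⇒m<1+n q<m))) (T-false (h m ≤-refl)))

lst : List ℕ → ℕ
lst []           = 0
lst (x ∷ [])     = x
lst (x ∷ y ∷ xs) = lst (y ∷ xs)

ascentBottom : ℕ → ℕ → ℕ
ascentBottom x y = if x <ᵇ y then x else 0

-- The floor of e: the largest lower end of an ascent of e (0 if there is none).
-- Appending v to e creates an occurrence of 1̲2̲0 exactly when v is below the floor.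
ascFloor : List ℕ → ℕ
ascFloor []           = 0
ascFloor (x ∷ [])     = 0
ascFloor (x ∷ y ∷ xs) = ascentBottom x y ⊔ ascFloor (y ∷ xs)

lastIs-lst : ∀ i x xs → lastIs i (x ∷ xs) ≡ (lst (x ∷ xs) ≡ᵇ i)
lastIs-lst i x []       = refl
lastIs-lst i x (y ∷ xs) = lastIs-lst i y xs

asc-≤-length : ∀ x xs → asc (x ∷ xs) ≤ length xs
asc-≤-length x []       = z≤n
asc-≤-length x (y ∷ xs) with x <ᵇ y
... | true  = s≤s (asc-≤-length y xs)
... | false = m≤n⇒m≤1+n (asc-≤-length y xs)

lst-∷ʳ : ∀ e v → lst (e ∷ʳ v) ≡ v
lst-∷ʳ []           v = refl
lst-∷ʳ (x ∷ [])     v = refl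
lst-∷ʳ (x ∷ y ∷ xs) v = lst-∷ʳ (y ∷ xs) v

asc-∷ʳ : ∀ x xs v → asc ((x ∷ xs) ∷ʳ v) ≡ ⟦ lst (x ∷ xs) <ᵇ v ⟧ + asc (x ∷ xs)
asc-∷ʳ x []       v = refl
asc-∷ʳ x (y ∷ xs) v = trans (cong (⟦ x <ᵇ y ⟧ +_) (asc-∷ʳ y xs v)) (x∙yz≈y∙xz ⟦ x <ᵇ y ⟧ ⟦ lst (y ∷ xs) <ᵇ v ⟧ (asc (y ∷ xs)))

ascFloor-∷ʳ : ∀ x xs v → ascFloor ((x ∷ xs) ∷ʳ v) ≡ ascFloor (x ∷ xs) ⊔ ascentBottom (lst (x ∷ xs)) v
ascFloor-∷ʳ x []       v = ⊔-identityʳ (ascentBottom x v)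
ascFloor-∷ʳ x (y ∷ xs) v =
  trans (cong (ascentBottom x y ⊔_) (ascFloor-∷ʳ y xs v)) (sym (⊔-assoc (ascentBottom x y) _ _))

isPrimitive-∷ʳ : ∀ x xs v → isPrimitive ((x ∷ xs) ∷ʳ v) ≡ isPrimitive (x ∷ xs) ∧ not (lst (x ∷ xs) ≡ᵇ v)
isPrimitive-∷ʳ x []       v = ∧-identityʳ _
isPrimitive-∷ʳ x (y ∷ xs) v =
  trans (cong (not (x ≡ᵇ y) ∧_) (isPrimitive-∷ʳ y xs v)) (sym (∧-assoc (not (x ≡ᵇ y)) _ _))

length-∷ʳ : ∀ (xs : List ℕ) v → length (xs ∷ʳ v) ≡ suc (length xs)
length-∷ʳ xs v = trans (length-++ xs) (+-comm (length xs) 1)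

at-∷ʳ-< : ∀ e v p → p < length e → at (e ∷ʳ v) p ≡ at e p
at-∷ʳ-< (x ∷ e) v zero    _         = refl
at-∷ʳ-< (x ∷ e) v (suc p) (s≤s p<n) = at-∷ʳ-< e v p p<n

at-∷ʳ-length : ∀ e v → at (e ∷ʳ v) (length e) ≡ v
at-∷ʳ-length []      v = refl
at-∷ʳ-length (x ∷ e) v = at-∷ʳ-length e v

take-∷ʳ : ∀ (e : List ℕ) v i → i ≤ length e → take i (e ∷ʳ v) ≡ take i e
take-∷ʳ e       v zero    _         = refl
take-∷ʳ (x ∷ e) v (suc i) (s≤s i≤n) = cong (x ∷_) (take-∷ʳ e v i i≤n)

take-length-∷ʳ : ∀ (e : List ℕ) v → take (length e) (e ∷ʳ v) ≡ e
take-length-∷ʳ e v = trans (take-∷ʳ e v (length e) ≤-refl) (take-all (length e) e ≤-refl)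

ascentTest : List ℕ → ℕ → Bool
ascentTest e p = at e p <ᵇ asc (take p e) + 2

isAscentSeq-upTo : ∀ x xs → isAscentSeq (x ∷ xs) ≡ all (ascentTest (x ∷ xs) ∘ suc) (upTo (length xs))
isAscentSeq-upTo x xs = cong and (sym (map-∘ (upTo (length xs))))

isAscentSeq-∷ʳ : ∀ x xs v →
  isAscentSeq ((x ∷ xs) ∷ʳ v) ≡ isAscentSeq (x ∷ xs) ∧ (v <ᵇ asc (x ∷ xs) + 2)
isAscentSeq-∷ʳ x xs v =
  begin
    isAscentSeq (x ∷ (xs ∷ʳ v))
  ≡⟨ isAscentSeq-upTo x (xs ∷ʳ v) ⟩
    all (ascentTest e′ ∘ suc) (upTo (length (xs ∷ʳ v)))
  ≡⟨ cong (all (ascentTest e′ ∘ suc) ∘ upTo) (length-∷ʳ xs v) ⟩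
    all (ascentTest e′ ∘ suc) (upTo (suc n))
  ≡⟨ all-upTo-∷ʳ (ascentTest e′ ∘ suc) n ⟩
    all (ascentTest e′ ∘ suc) (upTo n) ∧ ascentTest e′ (suc n)
  ≡⟨ cong₂ _∧_ (cong and (map-upTo-cong n earlier)) newest ⟩
    all (ascentTest e ∘ suc) (upTo n) ∧ (v <ᵇ asc e + 2)
  ≡⟨ cong (_∧ (v <ᵇ asc e + 2)) (sym (isAscentSeq-upTo x xs)) ⟩
    isAscentSeq e ∧ (v <ᵇ asc e + 2)
  ∎
  where
  open ≡-Reasoning
  e e′ : List ℕ
  e  = x ∷ xs
  e′ = e ∷ʳ v
  n : ℕ
  n = length xs
  earlier : ∀ p → p < n → ascentTest e′ (suc p) ≡ ascentTest e (suc p)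
  earlier p p<n =
    cong₂ (λ a t → a <ᵇ asc (x ∷ t) + 2) (at-∷ʳ-< xs v p p<n) (take-∷ʳ xs v p (<⇒≤ p<n))
  newest : ascentTest e′ (suc n) ≡ (v <ᵇ asc e + 2)
  newest = cong₂ (λ a t → a <ᵇ asc (x ∷ t) + 2) (at-∷ʳ-length xs v) (take-length-∷ʳ xs v)

patternTest : List ℕ → ℕ → ℕ → Bool
patternTest e p q = (p <ᵇ q) ∧ ((at e q <ᵇ at e (p ∸ 1)) ∧ (at e (p ∸ 1) <ᵇ at e p))

patternsFrom : List ℕ → ℕ → ℕ → Bool
patternsFrom e m p = any (patternTest e (suc p)) (upTo m)

contains-upTo : ∀ x xs →
  contains12̲0 (x ∷ xs) ≡ any (patternsFrom (x ∷ xs) (suc (length xs))) (upTo (length xs))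
contains-upTo x xs = cong or (sym (map-∘ (upTo (length xs))))

patternTest-∷ʳ : ∀ e v p q → q < length e → p < length e → patternTest (e ∷ʳ v) p q ≡ patternTest e p q
patternTest-∷ʳ e v p q q<n p<n =
  trans (cong₂ (λ a b → (p <ᵇ q) ∧ ((a <ᵇ b) ∧ (b <ᵇ at (e ∷ʳ v) p)))
               (at-∷ʳ-< e v q q<n) (at-∷ʳ-< e v (p ∸ 1) (≤-<-trans (m∸n≤m p 1) p<n)))
        (cong (λ c → (p <ᵇ q) ∧ ((at e q <ᵇ at e (p ∸ 1)) ∧ (at e (p ∸ 1) <ᵇ c))) (at-∷ʳ-< e v p p<n))

belowAscent : List ℕ → ℕ → ℕ → Bool
belowAscent e v p = (v <ᵇ at e p) ∧ (at e p <ᵇ at e (suc p))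

belowAscent-floor : ∀ x xs v → any (belowAscent (x ∷ xs) v) (upTo (length xs)) ≡ (v <ᵇ ascFloor (x ∷ xs))
belowAscent-floor x []       v = refl
belowAscent-floor x (y ∷ ys) v =
  begin
    belowAscent (x ∷ y ∷ ys) v 0 ∨ or (map (belowAscent (x ∷ y ∷ ys) v) (applyUpTo suc (length ys)))
  ≡⟨ cong (λ bs → belowAscent (x ∷ y ∷ ys) v 0 ∨ or bs) (map-shift (belowAscent (x ∷ y ∷ ys) v) (length ys)) ⟩
    ((v <ᵇ x) ∧ (x <ᵇ y)) ∨ any (belowAscent (y ∷ ys) v) (upTo (length ys))
  ≡⟨ cong₂ _∨_ (below-bottom (x <ᵇ y)) (belowAscent-floor y ys v) ⟩
    (v <ᵇ ascentBottom x y) ∨ (v <ᵇ ascFloor (y ∷ ys))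
  ≡⟨ sym (<ᵇ-⊔ v (ascentBottom x y) (ascFloor (y ∷ ys))) ⟩
    v <ᵇ ascFloor (x ∷ y ∷ ys)
  ∎
  where
  open ≡-Reasoning
  below-bottom : ∀ c → (v <ᵇ x) ∧ c ≡ (v <ᵇ (if c then x else 0))
  below-bottom true  = ∧-identityʳ (v <ᵇ x)
  below-bottom false = ∧-zeroʳ (v <ᵇ x)

-- The new occurrences of 1̲2̲0 created by appending v are exactly those ending in v.
contains-∷ʳ : ∀ x xs v →
  contains12̲0 ((x ∷ xs) ∷ʳ v) ≡ contains12̲0 (x ∷ xs) ∨ (v <ᵇ ascFloor (x ∷ xs))
contains-∷ʳ x xs v =
  begin
    contains12̲0 (x ∷ (xs ∷ʳ v))
  ≡⟨ contains-upTo x (xs ∷ʳ v) ⟩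
    any (patternsFrom e′ (suc (length (xs ∷ʳ v)))) (upTo (length (xs ∷ʳ v)))
  ≡⟨ cong (λ m → any (patternsFrom e′ (suc m)) (upTo m)) (length-∷ʳ xs v) ⟩
    any (patternsFrom e′ (2 + n)) (upTo (suc n))
  ≡⟨ any-upTo-∷ʳ (patternsFrom e′ (2 + n)) n ⟩
    any (patternsFrom e′ (2 + n)) (upTo n) ∨ patternsFrom e′ (2 + n) n
  ≡⟨ cong₂ _∨_ (cong or (map-upTo-cong n earlier)) none-at-end ⟩
    any (λ p → patternsFrom e (suc n) p ∨ belowAscent e v p) (upTo n) ∨ false
  ≡⟨ ∨-identityʳ _ ⟩
    any (λ p → patternsFrom e (suc n) p ∨ belowAscent e v p) (upTo n)
  ≡⟨ any-∨ (patternsFrom e (suc n)) (belowAscent e v) (upTo n) ⟩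
    any (patternsFrom e (suc n)) (upTo n) ∨ any (belowAscent e v) (upTo n)
  ≡⟨ cong₂ _∨_ (sym (contains-upTo x xs)) (belowAscent-floor x xs v) ⟩
    contains12̲0 e ∨ (v <ᵇ ascFloor e)
  ∎
  where
  open ≡-Reasoning
  e e′ : List ℕ
  e  = x ∷ xs
  e′ = e ∷ʳ v
  n : ℕ
  n = length xs
  newest : ∀ p → p < n → patternTest e′ (suc p) (suc n) ≡ belowAscent e v p
  newest p p<n =
    trans (cong₂ (λ c a → c ∧ ((a <ᵇ at e′ p) ∧ (at e′ p <ᵇ at e′ (suc p))))
                 (T-true (<⇒<ᵇ p<n)) (at-∷ʳ-length xs v))
          (cong₂ (λ a b → (v <ᵇ a) ∧ (a <ᵇ b))
                 (at-∷ʳ-< e v p (m<n⇒m<1+n p<n)) (at-∷ʳ-< e v (suc p) (s≤s p<n)))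
  earlier : ∀ p → p < n → patternsFrom e′ (2 + n) p ≡ (patternsFrom e (suc n) p ∨ belowAscent e v p)
  earlier p p<n =
    trans (any-upTo-∷ʳ (patternTest e′ (suc p)) (suc n))
          (cong₂ _∨_ (cong or (map-upTo-cong (suc n) (λ q q≤n → patternTest-∷ʳ e v (suc p) q q≤n (s≤s p<n))))
                     (newest p p<n))
  none-at-end : patternsFrom e′ (2 + n) n ≡ false
  none-at-end = any-upTo-false (patternTest e′ (suc n)) (2 + n)
                  (λ q q<2+n t → <⇒≱ (<ᵇ⇒< (suc n) q (proj₁ (∧-elim t))) (≤-pred q<2+n))

valid : List ℕ → Bool
valid e = isAscentSeq e ∧ (isPrimitive e ∧ avoids12̲0 e)

extensionTests : List ℕ → ℕ → List Bool
extensionTests e v = (v <ᵇ asc e + 2) ∷ not (lst e ≡ᵇ v) ∷ not (v <ᵇ ascFloor e) ∷ []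

extendable : List ℕ → ℕ → Bool
extendable e v = and (extensionTests e v)

extendable⇒ : ∀ e v → T (extendable e v) → v < asc e + 2 × lst e ≢ v × ascFloor e ≤ v
extendable⇒ e v h with and⁻ (extensionTests e v) h
... | fits ∷ fresh ∷ above ∷ [] = <ᵇ⇒< v _ fits , ≢ᵇ⇒≢ fresh , ≮ᵇ⇒≥ above

⇒extendable : ∀ e v → v < asc e + 2 → lst e ≢ v → ascFloor e ≤ v → T (extendable e v)
⇒extendable e v fits fresh above = and⁺ (<⇒<ᵇ fits ∷ ≢⇒≢ᵇ fresh ∷ ≥⇒≮ᵇ above ∷ [])

valid-∷ʳ : ∀ x xs v → valid ((x ∷ xs) ∷ʳ v) ≡ valid (x ∷ xs) ∧ extendable (x ∷ xs) v
valid-∷ʳ x xs v =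
  begin
    isAscentSeq e′ ∧ (isPrimitive e′ ∧ not (contains12̲0 e′))
  ≡⟨ cong₂ _∧_ (isAscentSeq-∷ʳ x xs v)
               (cong₂ (λ p c → p ∧ not c) (isPrimitive-∷ʳ x xs v) (contains-∷ʳ x xs v)) ⟩
    (asc-ok ∧ fits) ∧ ((prim ∧ fresh) ∧ not (bad ∨ below))
  ≡⟨ cong (λ z → (asc-ok ∧ fits) ∧ ((prim ∧ fresh) ∧ z)) (not-∨ bad below) ⟩
    (asc-ok ∧ fits) ∧ ((prim ∧ fresh) ∧ (not bad ∧ not below))
  ≡⟨ reorder asc-ok fits prim fresh (not bad) (not below) ⟩
    valid e ∧ extendable e v
  ∎
  where
  open ≡-Reasoning
  e e′ : List ℕ
  e  = x ∷ xs
  e′ = e ∷ʳ v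
  asc-ok fits prim fresh bad below : Bool
  asc-ok = isAscentSeq e
  fits   = v <ᵇ asc e + 2
  prim   = isPrimitive e
  fresh  = not (lst e ≡ᵇ v)
  bad    = contains12̲0 e
  below  = v <ᵇ ascFloor e
  reorder = solve 6 (λ a u p f c b → (a ∧′ u) ∧′ ((p ∧′ f) ∧′ (c ∧′ b)) ⊜ (a ∧′ (p ∧′ c)) ∧′ (u ∧′ (f ∧′ (b ∧′ true′)))) refl

-- The invariant of valid sequences starting with 0: floor ≤ last entry ≤ number of ascents.
Sound : List ℕ → Set
Sound e = T (valid e) → ascFloor e ≤ lst e × lst e ≤ asc e

sound-step : ∀ {f l a v} c → Reflects (l < v) c → f ≤ l → l ≤ a → v < a + 2 → l ≢ v → f ≤ v →
             f ⊔ (if c then l else 0) ≤ v × v ≤ ⟦ c ⟧ + a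
sound-step {a = a} {v} true (ofʸ l<v) f≤l _ v<a+2 _ _ =
  ⊔-lub (≤-trans f≤l (<⇒≤ l<v)) (<⇒≤ l<v) , ≤-pred (subst (v <_) (+-comm a 2) v<a+2)
sound-step {f} false (ofⁿ l≮v) _ l≤a _ l≢v f≤v =
  subst (_≤ _) (sym (⊔-identityʳ f)) f≤v , ≤-trans (<⇒≤ (≤∧≢⇒< (≮⇒≥ l≮v) (l≢v ∘ sym))) l≤a

Sound-∷ʳ : ∀ x xs v → Sound (x ∷ xs) → Sound ((x ∷ xs) ∷ʳ v)
Sound-∷ʳ x xs v sound valid-e′
  rewrite lst-∷ʳ (x ∷ xs) v | asc-∷ʳ x xs v | ascFloor-∷ʳ x xs v
  with ∧-elim (subst T (valid-∷ʳ x xs v) valid-e′)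
... | valid-e , ext with extendable⇒ (x ∷ xs) v ext | sound valid-e
... | fits , fresh , above | f≤l , l≤a =
  sound-step (lst (x ∷ xs) <ᵇ v) (<ᵇ-reflects-< (lst (x ∷ xs)) v) f≤l l≤a fits fresh above

-- The members of invSeqs (suc n): sound sequences x ∷ xs with n entries after the first.
data Shape (n : ℕ) : List ℕ → Set where
  shape : ∀ x xs → length xs ≡ n → Sound (x ∷ xs) → Shape n (x ∷ xs)

shapes : ∀ n → All (Shape n) (invSeqs (suc n))
shapes zero    = shape 0 [] refl (λ _ → z≤n , z≤n) ∷ []
shapes (suc n) = concat⁺ (map⁺ (All.map extend (shapes n)))
  where
  extend : ∀ {e} → Shape n e → All (Shape (suc n)) (map (e ∷ʳ_) (upTo (suc (suc n))))
  extend (shape x xs len sound) =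
    map⁺ (All.universal (λ v → shape x (xs ∷ʳ v) (trans (length-∷ʳ xs v) (cong suc len)) (Sound-∷ʳ x xs v sound)) _)

Σ< : ℕ → (ℕ → ℕ) → ℕ
Σ< zero    g = 0
Σ< (suc n) g = g 0 + Σ< n (g ∘ suc)

Σ<-zero : ∀ n g → (∀ j → g j ≡ 0) → Σ< n g ≡ 0
Σ<-zero zero    g _  = refl
Σ<-zero (suc n) g g0 = cong₂ _+_ (g0 0) (Σ<-zero n (g ∘ suc) (g0 ∘ suc))

Σ<-cong : ∀ n {g h} → (∀ j → j < n → g j ≡ h j) → Σ< n g ≡ Σ< n h
Σ<-cong zero    _  = refl
Σ<-cong (suc n) eq = cong₂ _+_ (eq 0 z<s) (Σ<-cong n (λ j j<n → eq (suc j) (s<s j<n)))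

Σ<-+ : ∀ n g h → Σ< n (λ j → g j + h j) ≡ Σ< n g + Σ< n h
Σ<-+ zero    g h = refl
Σ<-+ (suc n) g h =
  trans (cong (g 0 + h 0 +_) (Σ<-+ n (g ∘ suc) (h ∘ suc))) (interchange (g 0) (h 0) _ _)

Σ<-*ˡ : ∀ n c g → Σ< n (λ j → c * g j) ≡ c * Σ< n g
Σ<-*ˡ zero    c g = sym (*-zeroʳ c)
Σ<-*ˡ (suc n) c g = trans (cong (c * g 0 +_) (Σ<-*ˡ n c (g ∘ suc))) (sym (*-distribˡ-+ c (g 0) _))

Σ<-*ʳ : ∀ n c g → Σ< n (λ j → g j * c) ≡ Σ< n g * c
Σ<-*ʳ n c g =
  trans (Σ<-cong n (λ j _ → *-comm (g j) c)) (trans (Σ<-*ˡ n c g) (*-comm c (Σ< n g)))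

Σ<-swap : ∀ n m (g : ℕ → ℕ → ℕ) → Σ< n (λ j → Σ< m (g j)) ≡ Σ< m (λ t → Σ< n (λ j → g j t))
Σ<-swap zero    m g = sym (Σ<-zero m _ (λ _ → refl))
Σ<-swap (suc n) m g =
  trans (cong (Σ< m (g 0) +_) (Σ<-swap n m (g ∘ suc))) (sym (Σ<-+ m (g 0) (λ t → Σ< n (λ j → g (suc j) t))))

Σ<-split : ∀ n m g → Σ< (n + m) g ≡ Σ< n g + Σ< m (λ j → g (n + j))
Σ<-split zero    m g = refl
Σ<-split (suc n) m g = trans (cong (g 0 +_) (Σ<-split n m (g ∘ suc))) (sym (+-assoc (g 0) _ _))

Σ<-∷ʳ : ∀ n g → Σ< (suc n) g ≡ Σ< n g + g n
Σ<-∷ʳ zero    g = +-identityʳ (g 0)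
Σ<-∷ʳ (suc n) g = trans (cong (g 0 +_) (Σ<-∷ʳ n (g ∘ suc))) (sym (+-assoc (g 0) _ _))

Σ<-indicator : ∀ c n → Σ< n (λ j → ⟦ c ≡ᵇ j ⟧) ≡ ⟦ c <ᵇ n ⟧
Σ<-indicator c       zero    = refl
Σ<-indicator zero    (suc n) = cong suc (Σ<-zero n _ (λ _ → refl))
Σ<-indicator (suc c) (suc n) = Σ<-indicator c n

Σ<-delta : ∀ n i (h : ℕ → ℕ) → i < n → Σ< n (λ j → ⟦ j ≡ᵇ i ⟧ * h j) ≡ h i
Σ<-delta (suc n) zero    h _         =
  trans (cong₂ _+_ (+-identityʳ (h 0)) (Σ<-zero n _ (λ _ → refl))) (+-identityʳ (h 0))
Σ<-delta (suc n) (suc i) h (s≤s i<n) = Σ<-delta n i (h ∘ suc) i<n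

countB-++ : ∀ (P : List ℕ → Bool) xs ys → countB P (xs ++ ys) ≡ countB P xs + countB P ys
countB-++ P []       ys = refl
countB-++ P (x ∷ xs) ys = trans (cong (⟦ P x ⟧ +_) (countB-++ P xs ys)) (sym (+-assoc ⟦ P x ⟧ _ _))

countB-cong : ∀ {I : List ℕ → Set} {P Q : List ℕ → Bool} {xs} → All I xs →
              (∀ {x} → I x → P x ≡ Q x) → countB P xs ≡ countB Q xs
countB-cong []         eq = refl
countB-cong (ix ∷ ixs) eq = cong₂ (λ b n → ⟦ b ⟧ + n) (eq ix) (countB-cong ixs eq)

countB-none : ∀ {I : List ℕ → Set} {P : List ℕ → Bool} {xs} → All I xs →
              (∀ {x} → I x → ¬ T (P x)) → countB P xs ≡ 0
countB-none []         never = refl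
countB-none (ix ∷ ixs) never rewrite T-false (never ix) = countB-none ixs never

countB-∧-const : ∀ (P : List ℕ → Bool) c xs → countB (λ x → P x ∧ c) xs ≡ ⟦ c ⟧ * countB P xs
countB-∧-const P true  xs =
  trans (countB-cong (All.universal (λ _ → tt) xs) (λ {x} _ → ∧-identityʳ (P x))) (sym (+-identityʳ _))
countB-∧-const P false xs = countB-none (All.universal (λ _ → tt) xs) (λ {x} _ t → proj₂ (∧-elim {P x} t))

countB-concatMap : ∀ {I : List ℕ → Set} (P : List ℕ → Bool) (block : List ℕ → List (List ℕ)) (Q R : List ℕ → Bool) {xs} →
                   All I xs → (∀ {x} → I x → countB P (block x) ≡ ⟦ Q x ⟧ + ⟦ R x ⟧) →
                   countB P (concatMap block xs) ≡ countB Q xs + countB R xs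
countB-concatMap P block Q R []                 split = refl
countB-concatMap P block Q R {x ∷ xs} (ix ∷ ixs) split =
  begin
    countB P (block x ++ concatMap block xs)
  ≡⟨ countB-++ P (block x) (concatMap block xs) ⟩
    countB P (block x) + countB P (concatMap block xs)
  ≡⟨ cong₂ _+_ (split ix) (countB-concatMap P block Q R ixs split) ⟩
    (⟦ Q x ⟧ + ⟦ R x ⟧) + (countB Q xs + countB R xs)
  ≡⟨ interchange ⟦ Q x ⟧ ⟦ R x ⟧ (countB Q xs) (countB R xs) ⟩
    countB Q (x ∷ xs) + countB R (x ∷ xs)
  ∎
  where open ≡-Reasoning

indicator-split : ∀ c n K → (T c → n ≤ K) → ⟦ c ⟧ ≡ Σ< (suc K) (λ j → ⟦ c ∧ (n ≡ᵇ j) ⟧)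
indicator-split false n K _     = sym (Σ<-zero (suc K) _ (λ _ → refl))
indicator-split true  n K bound = sym (trans (Σ<-indicator n (suc K)) (cong ⟦_⟧ (T-true (<⇒<ᵇ (s≤s (bound tt))))))

countB-partition : ∀ (P : List ℕ → Bool) (h : List ℕ → ℕ) K {xs} → All (λ x → T (P x) → h x ≤ K) xs →
                   countB P xs ≡ Σ< (suc K) (λ j → countB (λ x → P x ∧ (h x ≡ᵇ j)) xs)
countB-partition P h K []                 = sym (Σ<-zero (suc K) _ (λ _ → refl))
countB-partition P h K {x ∷ xs} (bx ∷ bxs) =
  trans (cong₂ _+_ (indicator-split (P x) (h x) K bx) (countB-partition P h K bxs))
        (sym (Σ<-+ (suc K) (λ j → ⟦ P x ∧ (h x ≡ᵇ j) ⟧) (λ j → countB (λ y → P y ∧ (h y ≡ᵇ j)) xs)))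

countB-upTo-single : ∀ (P : List ℕ → Bool) (g : ℕ → List ℕ) i N → (∀ v → T (P (g v)) → v ≡ i) →
                     countB P (map g (upTo N)) ≡ ⟦ P (g i) ∧ (i <ᵇ N) ⟧
countB-upTo-single P g i zero    only = cong ⟦_⟧ (sym (∧-zeroʳ (P (g i))))
countB-upTo-single P g i (suc N) only =
  begin
    countB P (map g (upTo (suc N)))
  ≡⟨ cong (countB P ∘ map g) (sym (upTo-∷ʳ N)) ⟩
    countB P (map g (upTo N ++ [ N ]))
  ≡⟨ cong (countB P) (map-++ g (upTo N) [ N ]) ⟩
    countB P (map g (upTo N) ++ [ g N ])
  ≡⟨ countB-++ P (map g (upTo N)) [ g N ] ⟩
    countB P (map g (upTo N)) + (⟦ P (g N) ⟧ + 0)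
  ≡⟨ cong₂ _+_ (countB-upTo-single P g i N only) (+-identityʳ ⟦ P (g N) ⟧) ⟩
    ⟦ P (g i) ∧ (i <ᵇ N) ⟧ + ⟦ P (g N) ⟧
  ≡⟨ add-last (N ≟ i) ⟩
    ⟦ P (g i) ∧ (i <ᵇ suc N) ⟧
  ∎
  where
  open ≡-Reasoning
  add-last : Dec (N ≡ i) → ⟦ P (g i) ∧ (i <ᵇ N) ⟧ + ⟦ P (g N) ⟧ ≡ ⟦ P (g i) ∧ (i <ᵇ suc N) ⟧
  add-last (yes refl)
    rewrite T-false {N <ᵇ N} (n≮n N ∘ <ᵇ⇒< N N) | T-true (<⇒<ᵇ (n<1+n N))
          | ∧-zeroʳ (P (g N)) | ∧-identityʳ (P (g N))
    = refl
  add-last (no N≢i)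
    rewrite T-false (N≢i ∘ only N)
    = trans (+-identityʳ _) (cong (λ c → ⟦ P (g i) ∧ c ⟧)
        (T-ext (λ t → <⇒<ᵇ (m<n⇒m<1+n (<ᵇ⇒< i N t)))
               (λ t → <⇒<ᵇ (≤∧≢⇒< (≤-pred (<ᵇ⇒< i (suc N) t)) (N≢i ∘ sym)))))

F : ℕ → ℕ → ℕ → ℕ
F n k i = countB (counted k i) (invSeqs n)

withFloor : ℕ → ℕ → ℕ → List ℕ → Bool
withFloor k i b e = counted k i e ∧ (ascFloor e ≡ᵇ b)

G : ℕ → ℕ → ℕ → ℕ → ℕ
G n k i b = countB (withFloor k i b) (invSeqs n)

countedTests : ℕ → ℕ → List ℕ → List Bool
countedTests k i e = valid e ∷ (asc e ≡ᵇ k) ∷ (lst e ≡ᵇ i) ∷ []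

counted-∷ : ∀ k i x xs → counted k i (x ∷ xs) ≡ and (countedTests k i (x ∷ xs))
counted-∷ k i x xs rewrite lastIs-lst i x xs =
  solve 5 (λ a p v k l → a ∧′ (p ∧′ (v ∧′ (k ∧′ l))) ⊜ (a ∧′ (p ∧′ v)) ∧′ (k ∧′ (l ∧′ true′))) refl
    (isAscentSeq (x ∷ xs)) (isPrimitive (x ∷ xs)) (avoids12̲0 (x ∷ xs)) (asc (x ∷ xs) ≡ᵇ k) (lst (x ∷ xs) ≡ᵇ i)

counted⇒ : ∀ {k i x xs} → T (counted k i (x ∷ xs)) → All T (countedTests k i (x ∷ xs))
counted⇒ {k} {i} {x} {xs} t = and⁻ (countedTests k i (x ∷ xs)) (subst T (counted-∷ k i x xs) t)

⇒counted : ∀ {k i x xs} → All T (countedTests k i (x ∷ xs)) → T (counted k i (x ∷ xs))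
⇒counted {k} {i} {x} {xs} ts = subst T (sym (counted-∷ k i x xs)) (and⁺ ts)

appendTests : ℕ → ℕ → ℕ → List ℕ → ℕ → Bool → List Bool
appendTests k i b e v c =
  valid e ∷ extendable e v ∷ ((⟦ c ⟧ + asc e) ≡ᵇ k) ∷ (v ≡ᵇ i) ∷ ((ascFloor e ⊔ (if c then lst e else 0)) ≡ᵇ b) ∷ []

withFloor-∷ʳ : ∀ k i b x xs v →
  withFloor k i b ((x ∷ xs) ∷ʳ v) ≡ and (appendTests k i b (x ∷ xs) v (lst (x ∷ xs) <ᵇ v))
withFloor-∷ʳ k i b x xs v
  rewrite counted-∷ k i x (xs ∷ʳ v) | valid-∷ʳ x xs v | asc-∷ʳ x xs v | lst-∷ʳ (x ∷ xs) v | ascFloor-∷ʳ x xs v =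
  solve 5 (λ a u k l f → ((a ∧′ u) ∧′ (k ∧′ (l ∧′ true′))) ∧′ f ⊜ a ∧′ (u ∧′ (k ∧′ (l ∧′ (f ∧′ true′))))) refl
    (valid e) (extendable e v) ((⟦ c ⟧ + asc e) ≡ᵇ k) (v ≡ᵇ i) ((ascFloor e ⊔ (if c then lst e else 0)) ≡ᵇ b)
  where
  e : List ℕ
  e = x ∷ xs
  c : Bool
  c = lst e <ᵇ v

aboveTests : ℕ → ℕ → ℕ → List ℕ → List Bool
aboveTests k i b e = valid e ∷ (asc e ≡ᵇ k) ∷ (ascFloor e ≡ᵇ b) ∷ (i <ᵇ lst e) ∷ []

descent : ℕ → ℕ → ℕ → List ℕ → Bool
descent k i b e = and (aboveTests k i b e) ∧ not (i <ᵇ b)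

-- Appending i by an ascent: e is counted by f_{k-1,b} (its last entry b becomes the floor)
-- and b < i ≤ k.
ascent : ℕ → ℕ → ℕ → List ℕ → Bool
ascent zero    i b e = false
ascent (suc k) i b e = counted k b e ∧ ((b <ᵇ i) ∧ (i <ᵇ suc (suc k)))

append⇒descent : ∀ {k i b e} → lst e ≮ i → T (and (appendTests k i b e i false)) → T (descent k i b e)
append⇒descent {k} {i} {b} {e} l≮i t with and⁻ (appendTests k i b e i false) t
... | valid-e ∷ ext ∷ asc≡k ∷ _ ∷ floor≡b ∷ [] =
  let _ , fresh , above = extendable⇒ e i ext
      floor≡b′ = trans (sym (⊔-identityʳ (ascFloor e))) (≡ᵇ⇒≡ _ b floor≡b)
  in ∧-intro (and⁺ (valid-e ∷ asc≡k ∷ ≡⇒≡ᵇ _ b floor≡b′ ∷ <⇒<ᵇ (≤∧≢⇒< (≮⇒≥ l≮i) (fresh ∘ sym)) ∷ []))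
             (≥⇒≮ᵇ (subst (_≤ i) floor≡b′ above))

descent⇒append : ∀ {k i b e} → Sound e → T (descent k i b e) → T (and (appendTests k i b e i false))
descent⇒append {k} {i} {b} {e} sound t with ∧-elim t
... | above , i≮b with and⁻ (aboveTests k i b e) above
... | valid-e ∷ asc≡k ∷ floor≡b ∷ i<l ∷ [] =
  let i<lst = <ᵇ⇒< i _ i<l
      b≤i   = ≮ᵇ⇒≥ i≮b
      fits  = ≤-trans i<lst (≤-trans (proj₂ (sound valid-e)) (m≤m+n (asc e) 2))
      floor≤i = subst (_≤ i) (sym (≡ᵇ⇒≡ _ b floor≡b)) b≤i
  in and⁺ (valid-e ∷ ⇒extendable e i fits (≢-sym (<⇒≢ i<lst)) floor≤i ∷ asc≡k
           ∷ ≡⇒≡ᵇ i i refl ∷ subst (λ f → T (f ≡ᵇ b)) (sym (⊔-identityʳ (ascFloor e))) floor≡b ∷ [])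

append⇒ascent : ∀ {k i b x xs} → Sound (x ∷ xs) → lst (x ∷ xs) < i →
                 T (and (appendTests k i b (x ∷ xs) i true)) → T (ascent k i b (x ∷ xs))
append⇒ascent {zero}  {i} {b} {x} {xs} _ _ t with and⁻ (appendTests zero i b (x ∷ xs) i true) t
... | _ ∷ _ ∷ () ∷ _
append⇒ascent {suc k} {i} {b} {x} {xs} sound l<i t with and⁻ (appendTests (suc k) i b (x ∷ xs) i true) t
... | valid-e ∷ ext ∷ asc≡k ∷ _ ∷ floor≡b ∷ [] =
  let e = x ∷ xs
      fits , fresh , _ = extendable⇒ e i ext
      lst≡b = trans (sym (m≤n⇒m⊔n≡n (proj₁ (sound valid-e)))) (≡ᵇ⇒≡ _ b floor≡b)
      asc≡k′ = ≡ᵇ⇒≡ (asc e) k asc≡k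
      i<k+2 = subst (λ a → i < a + 2) asc≡k′ fits
  in ∧-intro (⇒counted {k} {b} {x} {xs} (valid-e ∷ asc≡k ∷ ≡⇒≡ᵇ _ b lst≡b ∷ []))
             (∧-intro (<⇒<ᵇ (subst (_< i) lst≡b l<i)) (<⇒<ᵇ (subst (i <_) (+-comm k 2) i<k+2)))

ascent⇒append : ∀ {k i b x xs} → Sound (x ∷ xs) →
                 T (ascent k i b (x ∷ xs)) → T (and (appendTests k i b (x ∷ xs) i true))
ascent⇒append {suc k} {i} {b} {x} {xs} sound t with ∧-elim t
... | counted-e , tests with counted⇒ {k} {b} {x} {xs} counted-e | ∧-elim tests
... | valid-e ∷ asc≡k ∷ lst≡b ∷ [] | b<i , i<k+2 =
  let e = x ∷ xs
      floor≤l , _ = sound valid-e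
      lst≡b′ = ≡ᵇ⇒≡ (lst e) b lst≡b
      l<i = subst (_< i) (sym lst≡b′) (<ᵇ⇒< b i b<i)
      fits = subst (λ a → i < a + 2) (sym (≡ᵇ⇒≡ (asc e) k asc≡k)) (subst (i <_) (+-comm 2 k) (<ᵇ⇒< i _ i<k+2))
  in and⁺ (valid-e ∷ ⇒extendable e i fits (<⇒≢ l<i) (≤-trans floor≤l (<⇒≤ l<i)) ∷ asc≡k ∷ ≡⇒≡ᵇ i i refl
           ∷ ≡⇒≡ᵇ _ b (trans (m≤n⇒m⊔n≡n floor≤l) lst≡b′) ∷ [])

descent⇒i<lst : ∀ {k i b e} → T (descent k i b e) → i < lst e
descent⇒i<lst {k} {i} {b} {e} t with and⁻ (aboveTests k i b e) (proj₁ (∧-elim t))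
... | _ ∷ _ ∷ _ ∷ i<l ∷ [] = <ᵇ⇒< i _ i<l

ascent⇒lst<i : ∀ {k i b x xs} → T (ascent k i b (x ∷ xs)) → lst (x ∷ xs) < i
ascent⇒lst<i {suc k} {i} {b} {x} {xs} t with ∧-elim t
... | counted-e , tests with counted⇒ {k} {b} {x} {xs} counted-e
... | _ ∷ _ ∷ lst≡b ∷ [] = subst (_< i) (sym (≡ᵇ⇒≡ _ b lst≡b)) (<ᵇ⇒< b i (proj₁ (∧-elim tests)))

append-split : ∀ k i b x xs → Sound (x ∷ xs) →
  ⟦ and (appendTests k i b (x ∷ xs) i (lst (x ∷ xs) <ᵇ i)) ⟧ ≡ ⟦ descent k i b (x ∷ xs) ⟧ + ⟦ ascent k i b (x ∷ xs) ⟧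
append-split k i b x xs sound with lst (x ∷ xs) <ᵇ i | <ᵇ-reflects-< (lst (x ∷ xs)) i
... | true | ofʸ l<i =
  trans (cong ⟦_⟧ (T-ext (append⇒ascent {k} {i} {b} {x} {xs} sound l<i) (ascent⇒append {k} {i} {b} {x} {xs} sound)))
        (cong (λ d → ⟦ d ⟧ + ⟦ ascent k i b (x ∷ xs) ⟧) (sym (T-false (<-asym l<i ∘ descent⇒i<lst {k} {i} {b} {x ∷ xs}))))
... | false | ofⁿ l≮i =
  trans (cong ⟦_⟧ (T-ext (append⇒descent {k} {i} {b} {x ∷ xs} l≮i) (descent⇒append {k} {i} {b} {x ∷ xs} sound)))
        (sym (trans (cong (λ a → ⟦ descent k i b (x ∷ xs) ⟧ + ⟦ a ⟧) (T-false (l≮i ∘ ascent⇒lst<i {k} {i} {b} {x} {xs})))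
                    (+-identityʳ _)))

extensions-count : ∀ n k i b {e} → Shape n e →
  countB (withFloor k i b) (map (e ∷ʳ_) (upTo (2 + n))) ≡ ⟦ descent k i b e ⟧ + ⟦ ascent k i b e ⟧
extensions-count n k i b (shape x xs len sound) =
  begin
    countB (withFloor k i b) (map (e ∷ʳ_) (upTo (2 + n)))
  ≡⟨ countB-upTo-single (withFloor k i b) (e ∷ʳ_) i (2 + n) ends-in-i ⟩
    ⟦ withFloor k i b (e ∷ʳ i) ∧ (i <ᵇ 2 + n) ⟧
  ≡⟨ cong ⟦_⟧ (T-ext (proj₁ ∘ ∧-elim) (λ t → ∧-intro t (<⇒<ᵇ (in-range t)))) ⟩
    ⟦ withFloor k i b (e ∷ʳ i) ⟧
  ≡⟨ cong ⟦_⟧ (withFloor-∷ʳ k i b x xs i) ⟩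
    ⟦ and (appendTests k i b e i (lst e <ᵇ i)) ⟧
  ≡⟨ append-split k i b x xs sound ⟩
    ⟦ descent k i b e ⟧ + ⟦ ascent k i b e ⟧
  ∎
  where
  open ≡-Reasoning
  e : List ℕ
  e = x ∷ xs
  tests : ∀ v → T (withFloor k i b (e ∷ʳ v)) → All T (appendTests k i b e v (lst e <ᵇ v))
  tests v t = and⁻ (appendTests k i b e v (lst e <ᵇ v)) (subst T (withFloor-∷ʳ k i b x xs v) t)
  ends-in-i : ∀ v → T (withFloor k i b (e ∷ʳ v)) → v ≡ i
  ends-in-i v t with tests v t
  ... | _ ∷ _ ∷ _ ∷ v≡i ∷ _ ∷ [] = ≡ᵇ⇒≡ v i v≡i
  in-range : T (withFloor k i b (e ∷ʳ i)) → i < 2 + n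
  in-range t with tests i t
  ... | _ ∷ ext ∷ _ ∷ _ ∷ _ ∷ [] =
    subst (i <_) (+-comm n 2)
          (≤-trans (proj₁ (extendable⇒ e i ext)) (+-monoˡ-≤ 2 (subst (asc e ≤_) len (asc-≤-length x xs))))

G-step : ∀ n k i b → G (2 + n) k i b ≡ countB (descent k i b) (invSeqs (suc n)) + countB (ascent k i b) (invSeqs (suc n))
G-step n k i b =
  countB-concatMap (withFloor k i b) (λ e → map (e ∷ʳ_) (upTo (2 + n))) (descent k i b) (ascent k i b)
                   (shapes n) (extensions-count n k i b)

descent-count : ∀ n k i b →
  countB (descent k i b) (invSeqs (suc n)) ≡ ⟦ not (i <ᵇ b) ⟧ * Σ< (suc k) (λ j → ⟦ i <ᵇ j ⟧ * G (suc n) k j b)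
descent-count n k i b =
  begin
    countB (λ e → and (aboveTests k i b e) ∧ not (i <ᵇ b)) (invSeqs (suc n))
  ≡⟨ countB-∧-const (and ∘ aboveTests k i b) (not (i <ᵇ b)) (invSeqs (suc n)) ⟩
    ⟦ not (i <ᵇ b) ⟧ * countB (and ∘ aboveTests k i b) (invSeqs (suc n))
  ≡⟨ cong (⟦ not (i <ᵇ b) ⟧ *_) (countB-partition (and ∘ aboveTests k i b) lst k (All.map lst≤k (shapes n))) ⟩
    ⟦ not (i <ᵇ b) ⟧ * Σ< (suc k) (λ j → countB (λ e → and (aboveTests k i b e) ∧ (lst e ≡ᵇ j)) (invSeqs (suc n)))
  ≡⟨ cong (⟦ not (i <ᵇ b) ⟧ *_) (Σ<-cong (suc k) (λ j _ →
       trans (countB-cong (shapes n) (by-last j)) (countB-∧-const (withFloor k j b) (i <ᵇ j) (invSeqs (suc n))))) ⟩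
    ⟦ not (i <ᵇ b) ⟧ * Σ< (suc k) (λ j → ⟦ i <ᵇ j ⟧ * G (suc n) k j b)
  ∎
  where
  open ≡-Reasoning
  lst≤k : ∀ {e} → Shape n e → T (and (aboveTests k i b e)) → lst e ≤ k
  lst≤k {e} (shape _ _ _ sound) t with and⁻ (aboveTests k i b e) t
  ... | valid-e ∷ asc≡k ∷ _ = subst (lst e ≤_) (≡ᵇ⇒≡ (asc e) k asc≡k) (proj₂ (sound valid-e))
  by-last : ∀ j {e} → Shape n e → and (aboveTests k i b e) ∧ (lst e ≡ᵇ j) ≡ withFloor k j b e ∧ (i <ᵇ j)
  by-last j (shape x xs _ _) = T-ext to from
    where
    e = x ∷ xs
    to : T (and (aboveTests k i b e) ∧ (lst e ≡ᵇ j)) → T (withFloor k j b e ∧ (i <ᵇ j))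
    to t with ∧-elim t
    ... | above , lst≡j with and⁻ (aboveTests k i b e) above
    ... | valid-e ∷ asc≡k ∷ floor≡b ∷ i<l ∷ [] =
      ∧-intro (∧-intro (⇒counted {k} {j} {x} {xs} (valid-e ∷ asc≡k ∷ lst≡j ∷ [])) floor≡b)
              (subst (λ l → T (i <ᵇ l)) (≡ᵇ⇒≡ (lst e) j lst≡j) i<l)
    from : T (withFloor k j b e ∧ (i <ᵇ j)) → T (and (aboveTests k i b e) ∧ (lst e ≡ᵇ j))
    from t with ∧-elim t
    ... | with-floor , i<j with ∧-elim with-floor
    ... | counted-e , floor≡b with counted⇒ {k} {j} {x} {xs} counted-e
    ... | valid-e ∷ asc≡k ∷ lst≡j ∷ [] =
      ∧-intro (and⁺ (valid-e ∷ asc≡k ∷ floor≡b ∷ subst (λ l → T (i <ᵇ l)) (sym (≡ᵇ⇒≡ (lst e) j lst≡j)) i<j ∷ []))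
              lst≡j

ascent-count : ∀ n k i b → countB (ascent (suc k) i b) (invSeqs n) ≡ ⟦ (b <ᵇ i) ∧ (i <ᵇ suc (suc k)) ⟧ * F n k b
ascent-count n k i b = countB-∧-const (counted k b) ((b <ᵇ i) ∧ (i <ᵇ suc (suc k))) (invSeqs n)

F-empty : ∀ k i → F 0 k i ≡ 0
F-empty zero    i = refl
F-empty (suc k) i = refl

F-short : ∀ n k i → n ≤ k → F n k i ≡ 0
F-short zero    k i _   = F-empty k i
F-short (suc n) k i n<k = countB-none (shapes n) too-short
  where
  too-short : ∀ {e} → Shape n e → ¬ T (counted k i e)
  too-short (shape x xs len _) t with counted⇒ {k} {i} {x} {xs} t
  ... | _ ∷ asc≡k ∷ _ =
    <⇒≱ n<k (subst (_≤ n) (≡ᵇ⇒≡ _ k asc≡k) (subst (asc (x ∷ xs) ≤_) len (asc-≤-length x xs)))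

-- The last entry of a counted sequence is at most its number of ascents.
F-high : ∀ n k i → k < i → F n k i ≡ 0
F-high zero    k i _   = F-empty k i
F-high (suc n) k i k<i = countB-none (shapes n) too-high
  where
  too-high : ∀ {e} → Shape n e → ¬ T (counted k i e)
  too-high (shape x xs _ sound) t with counted⇒ {k} {i} {x} {xs} t
  ... | valid-e ∷ asc≡k ∷ lst≡i ∷ [] =
    <⇒≱ k<i (subst₂ _≤_ (≡ᵇ⇒≡ _ i lst≡i) (≡ᵇ⇒≡ _ k asc≡k) (proj₂ (sound valid-e)))

F-by-floor : ∀ n k i → F (suc n) k i ≡ Σ< (suc i) (G (suc n) k i)
F-by-floor n k i = countB-partition (counted k i) ascFloor i (All.map floor≤i (shapes n))
  where
  floor≤i : ∀ {e} → Shape n e → T (counted k i e) → ascFloor e ≤ i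
  floor≤i (shape x xs _ sound) t with counted⇒ {k} {i} {x} {xs} t
  ... | valid-e ∷ _ ∷ lst≡i ∷ [] = subst (ascFloor (x ∷ xs) ≤_) (≡ᵇ⇒≡ _ i lst≡i) (proj₁ (sound valid-e))

hockey-stick : ∀ K i t → i ≤ K → Σ< (suc K) (λ j → ⟦ i <ᵇ j ⟧ * ((K ∸ j) C t)) ≡ (K ∸ i) C suc t
hockey-stick K       zero    t _         = trans (Σ<-cong K (λ j _ → +-identityʳ _)) (column K)
  where
  column : ∀ K → Σ< K (λ j → (K ∸ suc j) C t) ≡ K C suc t
  column zero    = refl
  column (suc K) = trans (cong (K C t +_) (column K)) (nCk+nC[k+1]≡[n+1]C[k+1] K t)
hockey-stick (suc K) (suc i) t (s≤s i≤K) = hockey-stick K i t i≤K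

below-or-equal : ∀ b i → b ≤ i → ⟦ b <ᵇ i ⟧ + ⟦ b ≡ᵇ i ⟧ ≡ 1
below-or-equal zero    zero    _         = refl
below-or-equal zero    (suc i) _         = refl
below-or-equal (suc b) (suc i) (s≤s b≤i) = below-or-equal b i b≤i

descents-sum : ∀ k p i b → i ≤ suc k →
  (∀ j → i < j → j ≤ suc k → G (suc p) (suc k) j b ≡ Σ< (suc p) (λ t → ((suc k ∸ j) C t) * F (p ∸ t) k b)) →
  Σ< (2 + k) (λ j → ⟦ i <ᵇ j ⟧ * G (suc p) (suc k) j b) ≡ Σ< (suc p) (λ t → ((suc k ∸ i) C suc t) * F (p ∸ t) k b)
descents-sum k p i b i≤k+1 larger =
  begin
    Σ< (suc K) (λ j → ⟦ i <ᵇ j ⟧ * G (suc p) K j b)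
  ≡⟨ Σ<-cong (suc K) use-larger ⟩
    Σ< (suc K) (λ j → ⟦ i <ᵇ j ⟧ * Σ< (suc p) (λ t → ((K ∸ j) C t) * Fk (p ∸ t)))
  ≡⟨ Σ<-cong (suc K) {h = λ j → Σ< (suc p) (λ t → ⟦ i <ᵇ j ⟧ * (((K ∸ j) C t) * Fk (p ∸ t)))}
               (λ j _ → sym (Σ<-*ˡ (suc p) ⟦ i <ᵇ j ⟧ (λ t → ((K ∸ j) C t) * Fk (p ∸ t)))) ⟩
    Σ< (suc K) (λ j → Σ< (suc p) (λ t → ⟦ i <ᵇ j ⟧ * (((K ∸ j) C t) * Fk (p ∸ t))))
  ≡⟨ Σ<-swap (suc K) (suc p) (λ j t → ⟦ i <ᵇ j ⟧ * (((K ∸ j) C t) * Fk (p ∸ t))) ⟩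
    Σ< (suc p) (λ t → Σ< (suc K) (λ j → ⟦ i <ᵇ j ⟧ * (((K ∸ j) C t) * Fk (p ∸ t))))
  ≡⟨ Σ<-cong (suc p) {h = λ t → ((K ∸ i) C suc t) * Fk (p ∸ t)} (λ t _ →
       trans (Σ<-cong (suc K) {h = λ j → (⟦ i <ᵇ j ⟧ * ((K ∸ j) C t)) * Fk (p ∸ t)}
                      (λ j _ → sym (*-assoc ⟦ i <ᵇ j ⟧ _ (Fk (p ∸ t)))))
             (trans (Σ<-*ʳ (suc K) (Fk (p ∸ t)) (λ j → ⟦ i <ᵇ j ⟧ * ((K ∸ j) C t)))
                    (cong (_* Fk (p ∸ t)) (hockey-stick K i t i≤k+1)))) ⟩
    Σ< (suc p) (λ t → ((K ∸ i) C suc t) * Fk (p ∸ t))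
  ∎
  where
  open ≡-Reasoning
  K : ℕ
  K = suc k
  Fk : ℕ → ℕ
  Fk q = F q k b
  use-larger : ∀ j → j < suc K →
    ⟦ i <ᵇ j ⟧ * G (suc p) K j b ≡ ⟦ i <ᵇ j ⟧ * Σ< (suc p) (λ t → ((K ∸ j) C t) * Fk (p ∸ t))
  use-larger j j<K+1 with i <ᵇ j | <ᵇ-reflects-< i j
  ... | false | _       = refl
  ... | true  | ofʸ i<j = cong (1 *_) (larger j i<j (≤-pred j<K+1))

-- A sequence ending in i comes by a descent from one ending in some j > i (collected by
-- descents-sum) or by an ascent from one ending in b < i; for b = i the correction term
-- plays the role of the ascents.
closed-form : ∀ k p i b → b ≤ i → i ≤ suc k →
  G (suc p) (suc k) i b + ⟦ b ≡ᵇ i ⟧ * F p k b ≡ Σ< (suc p) (λ t → ((suc k ∸ i) C t) * F (p ∸ t) k b)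
closed-form k zero    i b _   _       rewrite F-empty k b | *-zeroʳ ⟦ b ≡ᵇ i ⟧ = refl
closed-form k (suc p) i b b≤i i≤k+1 =
  begin
    G (2 + p) K i b + ⟦ b ≡ᵇ i ⟧ * Fk (suc p)
  ≡⟨ cong (_+ ⟦ b ≡ᵇ i ⟧ * Fk (suc p)) (G-step p K i b) ⟩
    (countB (descent K i b) (invSeqs (suc p)) + countB (ascent K i b) (invSeqs (suc p))) + ⟦ b ≡ᵇ i ⟧ * Fk (suc p)
  ≡⟨ cong₂ (λ d a → (d + a) + ⟦ b ≡ᵇ i ⟧ * Fk (suc p)) (descent-count p K i b) (ascent-count (suc p) k i b) ⟩
    (⟦ not (i <ᵇ b) ⟧ * descents + ⟦ (b <ᵇ i) ∧ (i <ᵇ suc K) ⟧ * Fk (suc p)) + ⟦ b ≡ᵇ i ⟧ * Fk (suc p)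
  ≡⟨ cong₂ (λ c d → (⟦ not c ⟧ * descents + ⟦ (b <ᵇ i) ∧ d ⟧ * Fk (suc p)) + ⟦ b ≡ᵇ i ⟧ * Fk (suc p))
           (T-false (≤⇒≯ b≤i ∘ <ᵇ⇒< i b)) (T-true (<⇒<ᵇ (s≤s i≤k+1))) ⟩
    (1 * descents + ⟦ (b <ᵇ i) ∧ true ⟧ * Fk (suc p)) + ⟦ b ≡ᵇ i ⟧ * Fk (suc p)
  ≡⟨ cong₂ (λ x c → (x + ⟦ c ⟧ * Fk (suc p)) + ⟦ b ≡ᵇ i ⟧ * Fk (suc p)) (*-identityˡ descents) (∧-identityʳ (b <ᵇ i)) ⟩
    (descents + ⟦ b <ᵇ i ⟧ * Fk (suc p)) + ⟦ b ≡ᵇ i ⟧ * Fk (suc p)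
  ≡⟨ +-assoc descents _ _ ⟩
    descents + (⟦ b <ᵇ i ⟧ * Fk (suc p) + ⟦ b ≡ᵇ i ⟧ * Fk (suc p))
  ≡⟨ cong₂ _+_ (descents-sum k p i b i≤k+1 larger) ascent-or-start ⟩
    Σ< (suc p) (λ t → ((K ∸ i) C suc t) * Fk (p ∸ t)) + Fk (suc p)
  ≡⟨ +-comm _ (Fk (suc p)) ⟩
    Fk (suc p) + Σ< (suc p) (λ t → ((K ∸ i) C suc t) * Fk (p ∸ t))
  ≡⟨ cong (_+ Σ< (suc p) (λ t → ((K ∸ i) C suc t) * Fk (p ∸ t))) (sym (*-identityˡ (Fk (suc p)))) ⟩
    Σ< (2 + p) (λ t → ((K ∸ i) C t) * Fk (suc p ∸ t))
  ∎
  where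
  open ≡-Reasoning
  K : ℕ
  K = suc k
  Fk : ℕ → ℕ
  Fk q = F q k b
  descents : ℕ
  descents = Σ< (suc K) (λ j → ⟦ i <ᵇ j ⟧ * G (suc p) K j b)
  ascent-or-start : ⟦ b <ᵇ i ⟧ * Fk (suc p) + ⟦ b ≡ᵇ i ⟧ * Fk (suc p) ≡ Fk (suc p)
  ascent-or-start =
    trans (sym (*-distribʳ-+ (Fk (suc p)) ⟦ b <ᵇ i ⟧ _))
          (trans (cong (_* Fk (suc p)) (below-or-equal b i b≤i)) (*-identityˡ (Fk (suc p))))
  -- the induction hypothesis; for j > i ≥ b the correction term vanishes
  larger : ∀ j → i < j → j ≤ K → G (suc p) K j b ≡ Σ< (suc p) (λ t → ((K ∸ j) C t) * Fk (p ∸ t))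
  larger j i<j j≤K =
    trans (sym (trans (cong (λ c → G (suc p) K j b + ⟦ c ⟧ * Fk p) (T-false (<⇒≢ b<j ∘ ≡ᵇ⇒≡ b j)))
                      (+-identityʳ _)))
          (closed-form k p j b (<⇒≤ b<j) j≤K)
    where
    b<j : b < j
    b<j = ≤-<-trans b≤i i<j

-- For p = m + k + 1 only the terms with t ≤ m survive, since F_q(k, b) = 0 for q ≤ k.
closed-form-truncated : ∀ k m i b → b ≤ i → i ≤ suc k →
  G (suc (m + k + 1)) (suc k) i b + ⟦ b ≡ᵇ i ⟧ * F (m + k + 1) k b
    ≡ Σ< (suc m) (λ t → ((suc k ∸ i) C t) * F (m ∸ t + k + 1) k b)
closed-form-truncated k m i b b≤i i≤k+1 =
  begin
    G (suc p) (suc k) i b + ⟦ b ≡ᵇ i ⟧ * F p k b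
  ≡⟨ closed-form k p i b b≤i i≤k+1 ⟩
    Σ< (suc p) term
  ≡⟨ cong (λ n → Σ< (suc n) term) (+-assoc m k 1) ⟩
    Σ< (suc m + (k + 1)) term
  ≡⟨ Σ<-split (suc m) (k + 1) term ⟩
    Σ< (suc m) term + Σ< (k + 1) (λ j → term (suc m + j))
  ≡⟨ cong (Σ< (suc m) term +_) (Σ<-zero (k + 1) _ too-short) ⟩
    Σ< (suc m) term + 0
  ≡⟨ +-identityʳ _ ⟩
    Σ< (suc m) term
  ≡⟨ Σ<-cong (suc m) (λ t t≤m → cong (λ q → ((suc k ∸ i) C t) * F q k b) (shift t (≤-pred t≤m))) ⟩
    Σ< (suc m) (λ t → ((suc k ∸ i) C t) * F (m ∸ t + k + 1) k b)
  ∎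
  where
  open ≡-Reasoning
  p : ℕ
  p = m + k + 1
  term : ℕ → ℕ
  term t = ((suc k ∸ i) C t) * F (p ∸ t) k b
  too-short : ∀ j → term (suc m + j) ≡ 0
  too-short j = trans (cong (((suc k ∸ i) C (suc m + j)) *_) (F-short _ k b short)) (*-zeroʳ ((suc k ∸ i) C (suc m + j)))
    where
    short : p ∸ (suc m + j) ≤ k
    short = subst (_≤ k) (sym (trans (cong (_∸ (suc m + j)) (+-comm (m + k) 1)) ([m+n]∸[m+o]≡n∸o (suc m) k j)))
                  (m∸n≤m k j)
  shift : ∀ t → t ≤ m → p ∸ t ≡ m ∸ t + k + 1
  shift t t≤m = trans (+-∸-comm 1 (≤-trans t≤m (m≤m+n m k))) (cong (_+ 1) (+-∸-comm k t≤m))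

sumTo-cong : ∀ n {g h : ℕ → ℤ} → (∀ j → g j ≡ h j) → sumTo n g ≡ sumTo n h
sumTo-cong zero    eq = eq 0
sumTo-cong (suc n) eq = cong₂ ℤ._+_ (sumTo-cong n eq) (eq (suc n))

sumTo-Σ< : ∀ n (g : ℕ → ℕ) → sumTo n (λ j → ℤ.+ g j) ≡ ℤ.+ Σ< (suc n) g
sumTo-Σ< zero    g = cong ℤ.+_ (sym (+-identityʳ (g 0)))
sumTo-Σ< (suc n) g =
  trans (cong (ℤ._+ ℤ.+ g (suc n)) (sumTo-Σ< n g))
        (trans (sym (ℤ.pos-+ (Σ< (suc n) g) (g (suc n)))) (cong ℤ.+_ (sym (Σ<-∷ʳ (suc n) g))))

sumTo-first-two : ∀ n (g : ℕ → ℤ) → (∀ s → g (2 + s) ≡ ℤ.+ 0) → sumTo (suc n) g ≡ g 0 ℤ.+ g 1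
sumTo-first-two zero    g _  = refl
sumTo-first-two (suc n) g g0 = trans (cong₂ ℤ._+_ (sumTo-first-two n g g0) (g0 n)) (ℤ.+-identityʳ _)

onePlusXPow-coeff : ∀ d t → onePlusXPow d t ≡ ℤ.+ (d C t)
onePlusXPow-coeff zero    zero    = refl
onePlusXPow-coeff zero    (suc t) = refl
onePlusXPow-coeff (suc d) zero    = trans (ℤ.*-identityˡ (onePlusXPow d 0)) (onePlusXPow-coeff d 0)
onePlusXPow-coeff (suc d) (suc t) =
  begin
    sumTo (suc t) (λ s → onePlusX s ℤ.* onePlusXPow d (suc t ∸ s))
  ≡⟨ sumTo-first-two t _ (λ _ → refl) ⟩
    ℤ.1ℤ ℤ.* onePlusXPow d (suc t) ℤ.+ ℤ.1ℤ ℤ.* onePlusXPow d t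
  ≡⟨ cong₂ ℤ._+_ (trans (ℤ.*-identityˡ _) (onePlusXPow-coeff d (suc t)))
                 (trans (ℤ.*-identityˡ _) (onePlusXPow-coeff d t)) ⟩
    ℤ.+ (d C suc t) ℤ.+ ℤ.+ (d C t)
  ≡⟨ sym (ℤ.pos-+ (d C suc t) (d C t)) ⟩
    ℤ.+ (d C suc t + d C t)
  ≡⟨ cong ℤ.+_ (trans (+-comm (d C suc t) (d C t)) (nCk+nC[k+1]≡[n+1]C[k+1] d t)) ⟩
    ℤ.+ (suc d C suc t)
  ∎
  where open ≡-Reasoning

convolution-coeff : ∀ d k j m →
  (onePlusXPow d ⊛ f k j) m ≡ ℤ.+ Σ< (suc m) (λ t → (d C t) * F (m ∸ t + k + 1) k j)
convolution-coeff d k j m =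
  trans (sumTo-cong m (λ t → trans (cong (ℤ._* f k j (m ∸ t)) (onePlusXPow-coeff d t))
                                   (sym (ℤ.pos-* (d C t) (F (m ∸ t + k + 1) k j)))))
        (sumTo-Σ< m (λ t → (d C t) * F (m ∸ t + k + 1) k j))

pos-+-∸ : ∀ a c → ℤ.+ a ≡ ℤ.+ (a + c) ℤ.- ℤ.+ c
pos-+-∸ a c = sym (begin
    ℤ.+ (a + c) ℤ.- ℤ.+ c            ≡⟨ cong (ℤ._- ℤ.+ c) (ℤ.pos-+ a c) ⟩
    (ℤ.+ a ℤ.+ ℤ.+ c) ℤ.- ℤ.+ c      ≡⟨ ℤ.+-assoc (ℤ.+ a) (ℤ.+ c) (ℤ.- ℤ.+ c) ⟩
    ℤ.+ a ℤ.+ (ℤ.+ c ℤ.- ℤ.+ c)      ≡⟨ cong (ℤ._+_ (ℤ.+ a)) (ℤ.+-inverseʳ (ℤ.+ c)) ⟩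
    ℤ.+ a ℤ.+ ℤ.0ℤ                  ≡⟨ ℤ.+-identityʳ (ℤ.+ a) ⟩
    ℤ.+ a                           ∎)
  where open ≡-Reasoning

-- No counted sequence of length ≥ 2 has no ascents and ends in 0: by the recurrence for G,
-- it would come by a descent from a sequence ending above 0 without ascents.
F-zero-zero : ∀ n → F (2 + n) 0 0 ≡ 0
F-zero-zero n =
  begin
    F (2 + n) 0 0
  ≡⟨ F-by-floor (suc n) 0 0 ⟩
    G (2 + n) 0 0 0 + 0
  ≡⟨ +-identityʳ _ ⟩
    G (2 + n) 0 0 0
  ≡⟨ G-step n 0 0 0 ⟩
    countB (descent 0 0 0) (invSeqs (suc n)) + countB (ascent 0 0 0) (invSeqs (suc n))
  ≡⟨ cong₂ _+_ (descent-count n 0 0 0) (countB-none (shapes n) (λ _ ())) ⟩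
    0
  ∎
  where open ≡-Reasoning

f-zero-zero : (m : ℕ) → f 0 0 m ≡ oneF m
f-zero-zero zero    = refl
f-zero-zero (suc n) =
  cong ℤ.+_ (trans (cong (λ q → F (suc q) 0 0) (trans (cong (_+ 1) (+-identityʳ n)) (+-comm n 1))) (F-zero-zero n))

f-vanishes : (k i : ℕ) → k < i → (m : ℕ) → f k i m ≡ zeroF m
f-vanishes k i k<i m = cong ℤ.+_ (F-high (m + k + 1) k i k<i)

f-recurrence : (k i : ℕ) → i ≤ suc k → (m : ℕ) →
  f (suc k) i m ≡ (sumF i (λ j → onePlusXPow (k + 1 ∸ i) ⊛ f k j) ⊖ f k i) m
f-recurrence k i i≤k+1 m =
  begin
    ℤ.+ F (m + suc k + 1) (suc k) i
  ≡⟨ cong (λ q → ℤ.+ F (q + 1) (suc k) i) (+-suc m k) ⟩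
    ℤ.+ F (suc p) (suc k) i
  ≡⟨ pos-+-∸ (F (suc p) (suc k) i) (F p k i) ⟩
    ℤ.+ (F (suc p) (suc k) i + F p k i) ℤ.- f k i m
  ≡⟨ cong (λ n → ℤ.+ n ℤ.- f k i m) counts ⟩
    ℤ.+ Σ< (suc i) (λ b → Σ< (suc m) (term b)) ℤ.- f k i m
  ≡⟨ cong (ℤ._- f k i m) (sym series) ⟩
    sumF i (λ j → onePlusXPow (k + 1 ∸ i) ⊛ f k j) m ℤ.- f k i m
  ∎
  where
  open ≡-Reasoning
  p : ℕ
  p = m + k + 1
  term : ℕ → ℕ → ℕ
  term b t = ((suc k ∸ i) C t) * F (m ∸ t + k + 1) k b
  counts : F (suc p) (suc k) i + F p k i ≡ Σ< (suc i) (λ b → Σ< (suc m) (term b))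
  counts =
    begin
      F (suc p) (suc k) i + F p k i
    ≡⟨ cong₂ _+_ (F-by-floor p (suc k) i) (sym (Σ<-delta (suc i) i (λ b → F p k b) ≤-refl)) ⟩
      Σ< (suc i) (G (suc p) (suc k) i) + Σ< (suc i) (λ b → ⟦ b ≡ᵇ i ⟧ * F p k b)
    ≡⟨ sym (Σ<-+ (suc i) (G (suc p) (suc k) i) (λ b → ⟦ b ≡ᵇ i ⟧ * F p k b)) ⟩
      Σ< (suc i) (λ b → G (suc p) (suc k) i b + ⟦ b ≡ᵇ i ⟧ * F p k b)
    ≡⟨ Σ<-cong (suc i) (λ b b≤i → closed-form-truncated k m i b (≤-pred b≤i) i≤k+1) ⟩
      Σ< (suc i) (λ b → Σ< (suc m) (term b))
    ∎
  series : sumF i (λ j → onePlusXPow (k + 1 ∸ i) ⊛ f k j) m ≡ ℤ.+ Σ< (suc i) (λ b → Σ< (suc m) (term b))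
  series =
    trans (sumTo-cong i (λ j → trans (cong (λ d → (onePlusXPow (d ∸ i) ⊛ f k j) m) (+-comm k 1))
                                     (convolution-coeff (suc k ∸ i) k j m)))
          (sumTo-Σ< i (λ b → Σ< (suc m) (term b)))

lemma2p2 : ((m : ℕ) → f 0 0 m ≡ oneF m)
           × ((k i : ℕ) → k < i → (m : ℕ) → f k i m ≡ zeroF m)
           × ((k i : ℕ) → i ≤ suc k → (m : ℕ) →
                f (suc k) i m
                  ≡ (sumF i (λ j → onePlusXPow (k + 1 ∸ i) ⊛ f k j) ⊖ f k i) m)
lemma2p2 = f-zero-zero , f-vanishes , f-recurrence
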